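{- Let $z$ be an indeterminate and let $(N_{n,k}(z))$ be defined by $N_{0,0}=1$, $N_{0,k}=0$ ($k>0$), and for $n\ge1$, $N_{n,k}=N_{n-1,k-1}+(z+1)N_{n-1,k}+zN_{n-1,k+1}$ for all $k\ge0$ (with $N_{n-1,-1}=0$). Then for all integers $m\ge n\ge0$, $$\sum_{k=0}^{m}z^k\,\mathrm{per}\begin{pmatrix}N_{n,k}(z)&N_{n,k+1}(z)\\ N_{m,k}(z)&N_{m,k+1}(z)\end{pmatrix}=N_{m+n,1}(z).$$
   Context: $\mathrm{per}\begin{pmatrix}a&b\\c&d\end{pmatrix}=ad+bc$. -}

module Defs where

open import Level using (Level)
open import Data.Nat using (ℕ; zero; suc)
open import Algebra.Bundles using (CommutativeRing)

module _ {c ℓ : Level} (R : CommutativeRing c ℓ) where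
  open CommutativeRing R using (Carrier; _+_; _*_; 0#; 1#)

  per : Carrier → Carrier → Carrier → Carrier → Carrier
  per a b c' d = a * d + b * c'

  pow : Carrier → ℕ → Carrier
  pow x zero    = 1#
  pow x (suc k) = x * pow x k

  N : Carrier → ℕ → ℕ → Carrier
  N z zero    zero    = 1#
  N z zero    (suc k) = 0#
  N z (suc n) zero    = (z + 1#) * N z n zero + z * N z n 1
  N z (suc n) (suc k) = N z n k + (z + 1#) * N z n (suc k) + z * N z n (suc (suc k))

  sumTo : ℕ → (ℕ → Carrier) → Carrier
  sumTo zero    f = f 0
  sumTo (suc m) f = sumTo m f + f (suc m)

module Submission where

-- Write ⟨u , v⟩ = Σₖ zᵏ (uₖ vₖ₊₁ + uₖ₊₁ vₖ) and let J = jacobi be the tridiagonal operator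
-- (J u)ₖ = uₖ₋₁ + (z + 1) uₖ + z uₖ₊₁ (with u₋₁ = 0) of the recurrence, so Nₙ₊₁ = J Nₙ.
-- Termwise, J is symmetric for ⟨ , ⟩ up to the telescoping flux zᵏ (uₖ₋₁ vₖ₊₁ − uₖ₊₁ vₖ₋₁),
-- which vanishes at both ends when u and v are finitely supported, as Nₙ is (on [0, n]).
-- Moving one J at a time, ⟨Nₙ , Nₘ⟩ = ⟨N₀ , Nₘ₊ₙ⟩ = Nₘ₊ₙ,₁. Since Nₘ vanishes beyond m,
-- truncating the sum at m or at m + n makes no difference.

open import Defs
open import Level using (Level)
open import Data.Nat as ℕ using (ℕ; zero; suc; _≤_; _<_; _≤′_; ≤′-refl; ≤′-step; z≤n; s≤s)
import Data.Nat.Properties as ℕₚ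
open import Algebra.Bundles using (CommutativeRing)
import Algebra.Properties.AbelianGroup as AbelianGroupProperties
import Algebra.Solver.Ring.NaturalCoefficients.Default as NatSolver
import Relation.Binary.Reasoning.Setoid as SetoidReasoning

module _ {c ℓ : Level} (R : CommutativeRing c ℓ) where
  open CommutativeRing R hiding (zero)
  open AbelianGroupProperties +-abelianGroup using (∙-cancelʳ)
  open NatSolver commutativeSemiring using (solve; _:=_; _:+_; _:*_; con)
  open SetoidReasoning setoid

  sumTo-cong : ∀ B {f g : ℕ → Carrier} → (∀ k → f k ≈ g k) → sumTo R B f ≈ sumTo R B g
  sumTo-cong zero    f≈g = f≈g 0
  sumTo-cong (suc B) f≈g = +-cong (sumTo-cong B f≈g) (f≈g (suc B))

  sumTo-telescope : ∀ {f g d : ℕ → Carrier} → (∀ k → f k + d (suc k) ≈ g k + d k) →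
                    ∀ B → sumTo R B f + d (suc B) ≈ sumTo R B g + d 0
  sumTo-telescope             step zero    = step 0
  sumTo-telescope {f} {g} {d} step (suc B) = begin
    sumTo R B f + f (suc B) + d (suc (suc B))   ≈⟨ +-assoc _ _ _ ⟩
    sumTo R B f + (f (suc B) + d (suc (suc B))) ≈⟨ +-congˡ (step (suc B)) ⟩
    sumTo R B f + (g (suc B) + d (suc B))       ≈⟨ swap _ _ _ ⟩
    sumTo R B f + d (suc B) + g (suc B)         ≈⟨ +-congʳ (sumTo-telescope step B) ⟩
    sumTo R B g + d 0 + g (suc B)               ≈⟨ swap _ _ _ ⟨
    sumTo R B g + (g (suc B) + d 0)             ≈⟨ +-assoc _ _ _ ⟨
    sumTo R B g + g (suc B) + d 0               ∎
    where
    swap : ∀ x y z → x + (y + z) ≈ x + z + y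
    swap = solve 3 (λ x y z → x :+ (y :+ z) := x :+ z :+ y) refl

  sumTo-extend : ∀ {B B'} {f : ℕ → Carrier} → B ≤ B' → (∀ k → B < k → f k ≈ 0#) →
                 sumTo R B' f ≈ sumTo R B f
  sumTo-extend {B} {f = f} B≤B' f≈0 = go (ℕₚ.≤⇒≤′ B≤B')
    where
    go : ∀ {B'} → B ≤′ B' → sumTo R B' f ≈ sumTo R B f
    go ≤′-refl        = refl
    go (≤′-step {C} B≤′C) = begin
      sumTo R C f + f (suc C) ≈⟨ +-congˡ (f≈0 (suc C) (s≤s (ℕₚ.≤′⇒≤ B≤′C))) ⟩
      sumTo R C f + 0#        ≈⟨ +-identityʳ _ ⟩
      sumTo R C f             ≈⟨ go B≤′C ⟩
      sumTo R B f             ∎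

  x+a+b≈y+c+d⇒x+[a-d]≈y+[c-b] : ∀ {x y a b c d} →
                                x + a + b ≈ y + c + d → x + (a - d) ≈ y + (c - b)
  x+a+b≈y+c+d⇒x+[a-d]≈y+[c-b] {x} {y} {a} {b} {c} {d} balanced = ∙-cancelʳ (b + d) _ _ (begin
    x + (a - d) + (b + d) ≈⟨ subtract-add x a b d ⟩
    x + a + b             ≈⟨ balanced ⟩
    y + c + d             ≈⟨ subtract-add y c d b ⟨
    y + (c - b) + (d + b) ≈⟨ +-congˡ (+-comm d b) ⟩
    y + (c - b) + (b + d) ∎)
    where
    subtract-add : ∀ w a b e → w + (a - e) + (b + e) ≈ w + a + b
    subtract-add w a b e = begin
      w + (a - e) + (b + e)   ≈⟨ solve 5 (λ w a b e e⁻ → w :+ (a :+ e⁻) :+ (b :+ e)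
                                                    := w :+ a :+ b :+ (e⁻ :+ e)) refl w a b e (- e) ⟩
      w + a + b + (- e + e)   ≈⟨ +-congˡ (-‿inverseˡ e) ⟩
      w + a + b + 0#          ≈⟨ +-identityʳ _ ⟩
      w + a + b               ∎

  a≈0∧b≈0⇒a-b≈0 : ∀ {a b} → a ≈ 0# → b ≈ 0# → a - b ≈ 0#
  a≈0∧b≈0⇒a-b≈0 a≈0 b≈0 = trans (+-cong a≈0 (-‿cong b≈0)) (-‿inverseʳ 0#)

  module _ (z : Carrier) where

    below : (ℕ → Carrier) → ℕ → Carrier
    below u zero    = 0#
    below u (suc k) = u k

    jacobi : (ℕ → Carrier) → ℕ → Carrier
    jacobi u k = below u k + (z + 1#) * u k + z * u (suc k)

    pairingTerm : (ℕ → Carrier) → (ℕ → Carrier) → ℕ → Carrier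
    pairingTerm u v k = pow R z k * per R (u k) (u (suc k)) (v k) (v (suc k))

    pairing : ℕ → (ℕ → Carrier) → (ℕ → Carrier) → Carrier
    pairing B u v = sumTo R B (pairingTerm u v)

    flux : (ℕ → Carrier) → (ℕ → Carrier) → ℕ → Carrier
    flux u v k = pow R z k * (below u k * v (suc k)) - pow R z k * (u (suc k) * below v k)

    pairing-cong : ∀ B {u u' v v'} → (∀ k → u k ≈ u' k) → (∀ k → v k ≈ v' k) →
                   pairing B u v ≈ pairing B u' v'
    pairing-cong B u≈u' v≈v' = sumTo-cong B λ k →
      *-congˡ (+-cong (*-cong (u≈u' k) (v≈v' (suc k))) (*-cong (u≈u' (suc k)) (v≈v' k)))

    pairingTerm-vanishesˡ : ∀ u v {k} → u k ≈ 0# → u (suc k) ≈ 0# → pairingTerm u v k ≈ 0#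
    pairingTerm-vanishesˡ u v {k} u₀≈0 u₁≈0 = begin
      pow R z k * (u k * v (suc k) + u (suc k) * v k)
        ≈⟨ *-congˡ (+-cong (*-congʳ u₀≈0) (*-congʳ u₁≈0)) ⟩
      pow R z k * (0# * v (suc k) + 0# * v k)
        ≈⟨ solve 3 (λ p a b → p :* (con 0 :* a :+ con 0 :* b) := con 0) refl (pow R z k) (v (suc k)) (v k) ⟩
      0# ∎

    pairingTerm-vanishesʳ : ∀ u v {k} → v k ≈ 0# → v (suc k) ≈ 0# → pairingTerm u v k ≈ 0#
    pairingTerm-vanishesʳ u v {k} v₀≈0 v₁≈0 = begin
      pow R z k * (u k * v (suc k) + u (suc k) * v k)
        ≈⟨ *-congˡ (+-cong (*-congˡ v₁≈0) (*-congˡ v₀≈0)) ⟩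
      pow R z k * (u k * 0# + u (suc k) * 0#)
        ≈⟨ solve 3 (λ p a b → p :* (a :* con 0 :+ b :* con 0) := con 0) refl (pow R z k) (u k) (u (suc k)) ⟩
      0# ∎

    pairingTerm-jacobi-flux : ∀ u v k → pairingTerm (jacobi u) v k + flux u v (suc k)
                                      ≈ pairingTerm u (jacobi v) k + flux u v k
    pairingTerm-jacobi-flux u v k = x+a+b≈y+c+d⇒x+[a-d]≈y+[c-b]
      (balance (pow R z k) z (below u k) (u k) (u (suc k)) (u (suc (suc k)))
                             (below v k) (v k) (v (suc k)) (v (suc (suc k))))
      where
      balance : ∀ p z u₋ u₀ u₁ u₂ v₋ v₀ v₁ v₂ →
        p * ((u₋ + (z + 1#) * u₀ + z * u₁) * v₁ + (u₀ + (z + 1#) * u₁ + z * u₂) * v₀)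
          + (z * p) * (u₀ * v₂) + p * (u₁ * v₋)
        ≈ p * (u₀ * (v₀ + (z + 1#) * v₁ + z * v₂) + u₁ * (v₋ + (z + 1#) * v₀ + z * v₁))
          + p * (u₋ * v₁) + (z * p) * (u₂ * v₀)
      balance = solve 10 (λ p z u₋ u₀ u₁ u₂ v₋ v₀ v₁ v₂ →
        p :* ((u₋ :+ (z :+ con 1) :* u₀ :+ z :* u₁) :* v₁ :+ (u₀ :+ (z :+ con 1) :* u₁ :+ z :* u₂) :* v₀)
          :+ (z :* p) :* (u₀ :* v₂) :+ p :* (u₁ :* v₋)
        := p :* (u₀ :* (v₀ :+ (z :+ con 1) :* v₁ :+ z :* v₂) :+ u₁ :* (v₋ :+ (z :+ con 1) :* v₀ :+ z :* v₁))
          :+ p :* (u₋ :* v₁) :+ (z :* p) :* (u₂ :* v₀)) refl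

    pairing-jacobi-sym : ∀ B u v → u (suc (suc B)) ≈ 0# → v (suc (suc B)) ≈ 0# →
                         pairing B (jacobi u) v ≈ pairing B u (jacobi v)
    pairing-jacobi-sym B u v u≈0 v≈0 = begin
      pairing B (jacobi u) v                      ≈⟨ +-identityʳ _ ⟨
      pairing B (jacobi u) v + 0#                 ≈⟨ +-congˡ outer-flux≈0 ⟨
      pairing B (jacobi u) v + flux u v (suc B)   ≈⟨ sumTo-telescope (pairingTerm-jacobi-flux u v) B ⟩
      pairing B u (jacobi v) + flux u v 0         ≈⟨ +-congˡ inner-flux≈0 ⟩
      pairing B u (jacobi v) + 0#                 ≈⟨ +-identityʳ _ ⟩
      pairing B u (jacobi v)                      ∎
      where
      p : Carrier
      p = pow R z (suc B)
      outer-flux≈0 : flux u v (suc B) ≈ 0#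
      outer-flux≈0 = a≈0∧b≈0⇒a-b≈0
        (trans (*-congˡ (trans (*-congˡ v≈0) (zeroʳ _))) (zeroʳ p))
        (trans (*-congˡ (trans (*-congʳ u≈0) (zeroˡ _))) (zeroʳ p))
      inner-flux≈0 : flux u v 0 ≈ 0#
      inner-flux≈0 = a≈0∧b≈0⇒a-b≈0
        (trans (*-identityˡ _) (zeroˡ _))
        (trans (*-identityˡ _) (zeroʳ _))

    N-suc : ∀ n k → N R z (suc n) k ≈ jacobi (N R z n) k
    N-suc n zero    = sym (+-congʳ (+-identityˡ _))
    N-suc n (suc k) = refl

    N-vanishes : ∀ {n k} → n < k → N R z n k ≈ 0#
    N-vanishes {zero}  {suc k} _         = refl
    N-vanishes {suc n} {suc k} (s≤s n<k) = begin
      N R z n k + (z + 1#) * N R z n (suc k) + z * N R z n (suc (suc k))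
        ≈⟨ +-cong (+-cong (N-vanishes n<k) (*-congˡ (N-vanishes (ℕₚ.m<n⇒m<1+n n<k))))
                  (*-congˡ (N-vanishes (ℕₚ.m<n⇒m<1+n (ℕₚ.m<n⇒m<1+n n<k)))) ⟩
      0# + (z + 1#) * 0# + z * 0#
        ≈⟨ solve 1 (λ z → con 0 :+ (z :+ con 1) :* con 0 :+ z :* con 0 := con 0) refl z ⟩
      0# ∎

    pairing-N-step : ∀ {B} n m → n ≤ suc B → m ≤ suc B →
                     pairing B (N R z (suc n)) (N R z m) ≈ pairing B (N R z n) (N R z (suc m))
    pairing-N-step {B} n m n≤1+B m≤1+B = begin
      pairing B (N R z (suc n)) (N R z m)       ≈⟨ pairing-cong B (N-suc n) (λ _ → refl) ⟩
      pairing B (jacobi (N R z n)) (N R z m)    ≈⟨ pairing-jacobi-sym B _ _ (N-vanishes (s≤s n≤1+B))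
                                                                            (N-vanishes (s≤s m≤1+B)) ⟩
      pairing B (N R z n) (jacobi (N R z m))    ≈⟨ pairing-cong B (λ _ → refl) (N-suc m) ⟨
      pairing B (N R z n) (N R z (suc m))       ∎

    pairing-N-shift : ∀ {B} n m → m ℕ.+ n ≤ B →
                      pairing B (N R z n) (N R z m) ≈ pairing B (N R z 0) (N R z (m ℕ.+ n))
    pairing-N-shift zero    m _ rewrite ℕₚ.+-identityʳ m = refl
    pairing-N-shift {B} (suc n) m m+n<B rewrite ℕₚ.+-suc m n =
      trans (pairing-N-step n m (≤1+B (ℕₚ.m≤n+m n m)) (≤1+B (ℕₚ.m≤m+n m n)))
            (pairing-N-shift n (suc m) m+n<B)
      where
      ≤1+B : ∀ {k} → k ≤ m ℕ.+ n → k ≤ suc B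
      ≤1+B k≤m+n = ℕₚ.m≤n⇒m≤1+n (ℕₚ.≤-trans k≤m+n (ℕₚ.<⇒≤ m+n<B))

    pairing-N₀ : ∀ B v → pairing B (N R z 0) v ≈ v 1
    pairing-N₀ B v = begin
      pairing B (N R z 0) v  ≈⟨ sumTo-extend {B' = B} z≤n
                                  (λ { (suc k) _ → pairingTerm-vanishesˡ (N R z 0) v refl refl }) ⟩
      pairing 0 (N R z 0) v  ≈⟨ solve 2 (λ a b → con 1 :* (con 1 :* a :+ con 0 :* b) := a)
                                      refl (v 1) (v 0) ⟩
      v 1                    ∎

open import Data.Nat using (_+_)

corollary3p4 : {c ℓ : Level} (R : CommutativeRing c ℓ) (z : CommutativeRing.Carrier R)
    (m n : ℕ) → n ≤ m →
    CommutativeRing._≈_ R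
      (sumTo R m (λ k → CommutativeRing._*_ R (pow R z k)
        (per R (N R z n k) (N R z n (suc k)) (N R z m k) (N R z m (suc k)))))
      (N R z (m + n) 1)
corollary3p4 R z m n _ = begin
  pairing R z m (N R z n) (N R z m)              ≈⟨ sumTo-extend R (ℕₚ.m≤m+n m n) vanishes ⟨
  pairing R z (m + n) (N R z n) (N R z m)        ≈⟨ pairing-N-shift R z n m ℕₚ.≤-refl ⟩
  pairing R z (m + n) (N R z 0) (N R z (m + n))  ≈⟨ pairing-N₀ R z (m + n) (N R z (m + n)) ⟩
  N R z (m + n) 1                                ∎
  where
  open CommutativeRing R using (setoid; _≈_; 0#)
  open SetoidReasoning setoid
  vanishes : ∀ k → m < k → pairingTerm R z (N R z n) (N R z m) k ≈ 0#
  vanishes k m<k = pairingTerm-vanishesʳ R z (N R z n) (N R z m)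
                     (N-vanishes R z m<k) (N-vanishes R z (ℕₚ.m<n⇒m<1+n m<k))
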